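{- Let $n\ge 2$ and let $K_n$ be the complete digraph on $[n]=\{1,\dots,n\}$ without loops (all arcs $(i,j)$ with $i\neq j$). Then $K_n$ is $(n-1)$-admissible. Moreover, for every integer $k$ with $1\leq k\leq n-1$ there exists a Boolean network $f:\{0,1\}^n\to\{0,1\}^n$ such that $G(f)=K_n$ and $i(f)=k$.
   Context: A Boolean network on $n$ variables is a map $f=(f_1,\dots,f_n):\{0,1\}^n\to\{0,1\}^n$. Its interaction graph $G(f)$ is the digraph on vertex set $[n]$ with an arc $(i,j)$ iff $f_j$ depends on variable $i$, i.e. there is $x\in\{0,1\}^n$ with $f_j(x_1,\dots,x_i=0,\dots,x_n)\neq f_j(x_1,\dots,x_i=1,\dots,x_n)$ (loops allowed). $\mathrm{FP}(f)=\{x: f(x)=x\}$ is the set of fixed points. For $I=\{i_1,\dots,i_k\}\subseteq[n]$ write $x_I=(x_{i_1},\dots,x_{i_k})$. A set $S\subseteq\{0,1\}^n$ is a covering array of strength $k$ if for every $k$-subset $I\subseteq[n]$ and every $a\in\{0,1\}^k$ there is $x\in S$ with $x_I=a$. $f$ is $k$-independent if $\mathrm{FP}(f)$ is a covering array of strength $k$; $i(f)$ is the maximum $k$ such that $f$ is $k$-independent. A digraph $G$ on $n$ vertices is $k$-admissible if there exists a $k$-independent Boolean network whose interaction graph is isomorphic to $G$. -}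

module Defs where

open import Data.Nat using (ℕ; _<_; _≤_)
open import Data.Fin using (Fin; _≟_)
open import Data.Bool using (Bool; true; false)
open import Data.Product using (Σ; ∃; _×_)
open import Relation.Nullary using (¬_; yes; no)
open import Relation.Binary.PropositionalEquality using (_≡_; _≢_)
open import Function.Bundles using (_⇔_; _↔_; Inverse)
open import Function.Definitions using (Injective)

Config : ℕ → Set
Config n = Fin n → Bool

BN : ℕ → Set
BN n = Config n → Config n

set : ∀ {n} → Config n → Fin n → Bool → Config n
set x i b j with j ≟ i
... | yes _ = b
... | no  _ = x j

Digraph : ℕ → Set₁
Digraph n = Fin n → Fin n → Set

G : ∀ {n} → BN n → Digraph n
G {n} f i j = ∃ λ (x : Config n) → f (set x i false) j ≢ f (set x i true) j

K : (n : ℕ) → Digraph n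
K n i j = i ≢ j

_≐_ : ∀ {n} → Digraph n → Digraph n → Set
_≐_ {n} D E = (i j : Fin n) → D i j ⇔ E i j

_≅_ : ∀ {n} → Digraph n → Digraph n → Set
_≅_ {n} D E = Σ (Fin n ↔ Fin n) λ π →
  (i j : Fin n) → D i j ⇔ E (Inverse.to π i) (Inverse.to π j)

IsFixedPoint : ∀ {n} → BN n → Config n → Set
IsFixedPoint {n} f x = (j : Fin n) → f x j ≡ x j

-- f is k-independent: for every k-subset I of [n] (given as an injective
-- enumeration I : Fin k → Fin n) and every a ∈ {0,1}^k, some fixed point
-- x satisfies x_I = a.
Independent : ∀ {n} → ℕ → BN n → Set
Independent {n} k f =
  (I : Fin k → Fin n) → Injective _≡_ _≡_ I →
  (a : Fin k → Bool) →
  ∃ λ (x : Config n) → IsFixedPoint f x × ((t : Fin k) → x (I t) ≡ a t)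

IndepNumber : ∀ {n} → BN n → ℕ → Set
IndepNumber {n} f k =
  k ≤ n × Independent k f × ((m : ℕ) → k < m → m ≤ n → ¬ Independent m f)

Admissible : ∀ {n} → ℕ → Digraph n → Set
Admissible {n} k D = ∃ λ (f : BN n) → Independent k f × (G f ≅ D)

{-# OPTIONS --safe #-}
-- For d ≥ 1 let f_j(x) = 1 iff d + 1 does not divide the number of ones of x
-- outside coordinate j. Each f_j ignores x_j and depends on every other
-- coordinate, so G(f) = K_n. Every x whose weight is a multiple of d + 1 is a
-- fixed point, so if k + d ≤ n any pattern on k coordinates extends, by
-- switching on at most d of the other n − k coordinates, to a fixed point.
-- Conversely a fixed point with a zero coordinate has weight divisible by
-- d + 1, so the pattern 1 0 … 0 on the first m coordinates, which bounds the
-- weight by n − m + 1, occurs in no fixed point once n < m + d.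
-- Taking d = n − k gives i(f) = k.
module Submission where

open import Defs
open import Data.Nat using (ℕ; zero; suc; _+_; _∸_; _≤_; _<_; z≤n; s≤s; s≤s⁻¹)
open import Data.Nat.Properties
  using (≤-refl; ≤-reflexive; ≤-trans; <⇒≤; <⇒≱; m≤n⇒m≤1+n; +-suc; +-comm;
         +-identityʳ; +-mono-≤; +-monoʳ-≤; +-monoˡ-<; m+[n∸m]≡n; m<n⇒0<n∸m)
open import Data.Nat.Divisibility
  using (_∣_; _∤_; _∣?_; _∣0; n∣n; ∣1⇒≡1; ∣⇒≤; ∣m∣n⇒∣m+n; ∣m+n∣m⇒∣n)
open import Data.Fin using (Fin; zero; suc; _≟_; inject≤)
open import Data.Fin.Properties using (0≢1+n; suc-injective; inject≤-injective)
open import Data.Bool using (Bool; true; false; not)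
open import Data.Vec.Functional using (_∷_; head; tail)
open import Data.Product using (∃; _×_; _,_)
open import Function using (_∘_; id; const)
open import Function.Bundles using (mk⇔)
open import Function.Construct.Identity using (↔-id)
open import Function.Definitions using (Injective)
open import Relation.Nullary using (¬_; Dec; yes; no; does; contradiction)
open import Relation.Nullary.Decidable using (dec-true; dec-false)
open import Relation.Binary.PropositionalEquality

private variable
  k m n : ℕ

set-≡ : (x : Config n) (i : Fin n) (b : Bool) → set x i b i ≡ b
set-≡ x i b with i ≟ i
... | yes _   = refl
... | no i≢i = contradiction refl i≢i

set-≢ : (x : Config n) {i j : Fin n} (b : Bool) → j ≢ i → set x i b j ≡ x j
set-≢ x {i} {j} b j≢i with j ≟ i
... | yes j≡i = contradiction j≡i j≢i
... | no _    = refl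

set-id : (x : Config n) (i : Fin n) {b : Bool} → x i ≡ b → set x i b ≗ x
set-id x i xi≡b j with j ≟ i
... | yes refl = sym xi≡b
... | no _     = refl

set-set : (x : Config n) (i : Fin n) (b c : Bool) → set (set x i b) i c ≗ set x i c
set-set x i b c j with j ≟ i
... | yes _   = refl
... | no j≢i = set-≢ x b j≢i

set-suc : (x : Config (suc n)) (i : Fin n) (b : Bool) →
          tail (set x (suc i) b) ≗ set (tail x) i b
set-suc x i b j with j ≟ i
... | yes _ = refl
... | no _  = refl

set-true-mono : (x : Config n) (i : Fin n) {j : Fin n} → x j ≡ true → set x i true j ≡ true
set-true-mono x i {j} xj≡true with j ≟ i
... | yes _ = refl
... | no _  = xj≡true

addBit : Bool → ℕ → ℕ
addBit true  = suc
addBit false = id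

addBit-suc : (b : Bool) (w : ℕ) → addBit b (suc w) ≡ suc (addBit b w)
addBit-suc true  w = refl
addBit-suc false w = refl

addBit-+ : (b : Bool) (w t : ℕ) → addBit b w + t ≡ addBit b (w + t)
addBit-+ true  w t = refl
addBit-+ false w t = refl

weight : Config n → ℕ
weight {zero}  x = 0
weight {suc n} x = addBit (head x) (weight (tail x))

weight-cong : {x y : Config n} → x ≗ y → weight x ≡ weight y
weight-cong {zero}  x≗y = refl
weight-cong {suc n} x≗y = cong₂ addBit (x≗y zero) (weight-cong (x≗y ∘ suc))

weight-const-false : weight {n} (const false) ≡ 0
weight-const-false {zero}  = refl
weight-const-false {suc n} = weight-const-false {n}

weight-≤ : (x : Config n) → weight x ≤ n
weight-≤ {zero}  x = z≤n
weight-≤ {suc n} x with x zero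
... | true  = s≤s (weight-≤ (tail x))
... | false = m≤n⇒m≤1+n (weight-≤ (tail x))

weight-set-true : (x : Config n) (i : Fin n) →
                  weight (set x i true) ≡ suc (weight (set x i false))
weight-set-true x zero    = refl
weight-set-true x (suc i) = begin
  addBit (x zero) (weight (tail (set x (suc i) true)))
    ≡⟨ cong (addBit (x zero)) (weight-cong (set-suc x i true)) ⟩
  addBit (x zero) (weight (set (tail x) i true))
    ≡⟨ cong (addBit (x zero)) (weight-set-true (tail x) i) ⟩
  addBit (x zero) (suc (weight (set (tail x) i false)))
    ≡⟨ addBit-suc (x zero) _ ⟩
  suc (addBit (x zero) (weight (set (tail x) i false)))
    ≡⟨ cong (suc ∘ addBit (x zero)) (weight-cong (set-suc x i false)) ⟨
  suc (addBit (x zero) (weight (tail (set x (suc i) false)))) ∎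
  where open ≡-Reasoning

weight-set-true-≤ : (x : Config n) (i : Fin n) → weight (set x i true) ≤ suc (weight x)
weight-set-true-≤ x i with x i in xi
... | true  = m≤n⇒m≤1+n (≤-reflexive (weight-cong (set-id x i xi)))
... | false = ≤-reflexive (trans (weight-set-true x i) (cong suc (weight-cong (set-id x i xi))))

raise-weight : (P z : Config n) (t : ℕ) → (∀ j → P j ≡ false → z j ≡ false) →
               weight P + t ≤ n →
               ∃ λ x → (∀ j → P j ≡ true → x j ≡ z j) × weight x ≡ weight z + t
raise-weight P z zero _ _ = z , (λ _ _ → refl) , sym (+-identityʳ (weight z))
raise-weight {suc n} P z (suc t) z-off-P room with P zero in P₀
... | true
  with x , x-on-P , weight-x ← raise-weight (tail P) (tail z) (suc t) (z-off-P ∘ suc)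
                                   (s≤s⁻¹ room)
  = z zero ∷ x
  , (λ { zero _ → refl ; (suc j) → x-on-P j })
  , trans (cong (addBit (z zero)) weight-x) (sym (addBit-+ (z zero) _ _))
... | false
  with x , x-on-P , weight-x ← raise-weight (tail P) (tail z) t (z-off-P ∘ suc)
                                   (s≤s⁻¹ (subst (_≤ suc n) (+-suc _ t) room))
  = true ∷ x
  , (λ { zero P₀≡true → contradiction (trans (sym P₀) P₀≡true) λ ()
       ; (suc j) → x-on-P j })
  , (begin
      suc (weight x)             ≡⟨ cong suc weight-x ⟩
      suc (weight (tail z) + t)  ≡⟨ +-suc (weight (tail z)) t ⟨
      weight (tail z) + suc t    ≡⟨ cong (λ b → addBit b (weight (tail z)) + suc t) (z-off-P zero P₀) ⟨
      weight z + suc t           ∎)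
  where open ≡-Reasoning

image : (Fin k → Fin n) → Config n
image {zero}  I = const false
image {suc k} I = set (image (tail I)) (head I) true

image-∋ : (I : Fin k → Fin n) (t : Fin k) → image I (I t) ≡ true
image-∋ I zero    = set-≡ (image (tail I)) (I zero) true
image-∋ I (suc t) = set-true-mono (image (tail I)) (I zero) (image-∋ (tail I) t)

weight-image-≤ : (I : Fin k → Fin n) → weight (image I) ≤ k
weight-image-≤ {zero} {n} I = ≤-reflexive (weight-const-false {n})
weight-image-≤ {suc k} I =
  ≤-trans (weight-set-true-≤ (image (tail I)) (I zero)) (s≤s (weight-image-≤ (tail I)))

assign : (Fin k → Fin n) → (Fin k → Bool) → Config n
assign {zero}  I a = const false
assign {suc k} I a = set (assign (tail I) (tail a)) (head I) (head a)

assign-∘ : (I : Fin k → Fin n) → Injective _≡_ _≡_ I →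
           (a : Fin k → Bool) (t : Fin k) → assign I a (I t) ≡ a t
assign-∘ I I-inj a zero    = set-≡ (assign (tail I) (tail a)) (I zero) (a zero)
assign-∘ I I-inj a (suc t) = begin
  assign I a (I (suc t))
    ≡⟨ set-≢ (assign (tail I) (tail a)) (a zero) (0≢1+n ∘ sym ∘ I-inj) ⟩
  assign (tail I) (tail a) (I (suc t))
    ≡⟨ assign-∘ (tail I) (suc-injective ∘ I-inj) (tail a) t ⟩
  a (suc t) ∎
  where open ≡-Reasoning

assign-outside : (I : Fin k → Fin n) (a : Fin k → Bool) (j : Fin n) →
                 image I j ≡ false → assign I a j ≡ false
assign-outside {zero}  I a j _ = refl
assign-outside {suc k} I a j j∉I with j ≟ I zero
... | yes refl = contradiction j∉I λ ()
... | no _     = assign-outside (tail I) (tail a) j j∉I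

∃-multiple-within : (d c : ℕ) → ∃ λ t → t ≤ d × suc d ∣ c + t
∃-multiple-within d zero = 0 , z≤n , suc d ∣0
∃-multiple-within d (suc c) with ∃-multiple-within d c
... | zero , _ , ∣c+0 =
  d , ≤-refl
  , subst (suc d ∣_) (+-suc c d)
          (∣m∣n⇒∣m+n (subst (suc d ∣_) (+-identityʳ c) ∣c+0) n∣n)
... | suc t , t<d , ∣c+1+t = t , <⇒≤ t<d , subst (suc d ∣_) (+-suc c t) ∣c+1+t

∣suc⇒∤ : {d w : ℕ} → 0 < d → suc d ∣ suc w → suc d ∤ w
∣suc⇒∤ {suc d} {w} _ ∣1+w ∣w
  with () ← ∣1⇒≡1 (∣m+n∣m⇒∣n (subst (suc (suc d) ∣_) (+-comm 1 w) ∣1+w) ∣w)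

modNetwork : ℕ → BN n
modNetwork d x j = not (does (suc d ∣? weight (set x j false)))

modNetwork-≡false : (d : ℕ) (x : Config n) (j : Fin n) →
                    suc d ∣ weight (set x j false) → modNetwork d x j ≡ false
modNetwork-≡false d x j ∣w = cong not (dec-true (suc d ∣? _) ∣w)

modNetwork-≡true : (d : ℕ) (x : Config n) (j : Fin n) →
                   suc d ∤ weight (set x j false) → modNetwork d x j ≡ true
modNetwork-≡true d x j ∤w = cong not (dec-false (suc d ∣? _) ∤w)

modNetwork-fixed : (d : ℕ) → 0 < d → (x : Config n) → suc d ∣ weight x →
                   IsFixedPoint (modNetwork d) x
modNetwork-fixed d 0<d x ∣x j with x j in xj
... | false =
  modNetwork-≡false d x j (subst (suc d ∣_) (sym (weight-cong (set-id x j xj))) ∣x)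
... | true  = modNetwork-≡true d x j (∣suc⇒∤ 0<d (subst (suc d ∣_) weight-x ∣x))
  where
  weight-x : weight x ≡ suc (weight (set x j false))
  weight-x = trans (sym (weight-cong (set-id x j xj))) (weight-set-true x j)

modNetwork-fixed⇒∣ : (d : ℕ) (x : Config n) → IsFixedPoint (modNetwork d) x →
                     {j : Fin n} → x j ≡ false → suc d ∣ weight x
modNetwork-fixed⇒∣ d x x-fixed {j} xj =
  subst (suc d ∣_) (weight-cong (set-id x j xj))
        (not-does≡false (suc d ∣? _) (trans (x-fixed j) xj))
  where
  not-does≡false : {A : Set} (a? : Dec A) → not (does a?) ≡ false → A
  not-does≡false (yes a) _  = a
  not-does≡false (no _)  ()

modNetwork-graph : (d : ℕ) → 0 < d → G (modNetwork {n} d) ≐ K n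
modNetwork-graph {n} d 0<d i j = mk⇔ (no-loop i j) (arc i j)
  where
  no-loop : ∀ i j → G (modNetwork d) i j → i ≢ j
  no-loop i .i (x , differs) refl = differs (cong (λ w → not (does (suc d ∣? w)))
    (trans (weight-cong (set-set x i false false)) (sym (weight-cong (set-set x i true false)))))

  arc : ∀ i j → i ≢ j → G (modNetwork d) i j
  arc i j i≢j = const false , λ eq → contradiction (trans (sym off) (trans eq on)) λ ()
    where
    off : modNetwork d (set (const false) i false) j ≡ false
    off = modNetwork-≡false d _ j (subst (suc d ∣_) (sym (begin
      weight (set (set (const false) i false) j false)
        ≡⟨ weight-cong (set-id _ j (set-id (const false) i refl j)) ⟩
      weight (set (const false) i false)
        ≡⟨ weight-cong (set-id (const false) i refl) ⟩
      weight {n} (const false)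
        ≡⟨ weight-const-false {n} ⟩
      0 ∎)) (suc d ∣0))
      where open ≡-Reasoning
    on : modNetwork d (set (const false) i true) j ≡ true
    on = modNetwork-≡true d _ j (subst (suc d ∤_) (sym (begin
      weight (set (set (const false) i true) j false)
        ≡⟨ weight-cong (set-id _ j (set-≢ (const false) true (i≢j ∘ sym))) ⟩
      weight (set (const false) i true)
        ≡⟨ weight-set-true (const false) i ⟩
      suc (weight (set (const false) i false))
        ≡⟨ cong suc (weight-cong (set-id (const false) i refl)) ⟩
      suc (weight {n} (const false))
        ≡⟨ cong suc (weight-const-false {n}) ⟩
      1 ∎)) λ ∣1 → ∣suc⇒∤ 0<d ∣1 (suc d ∣0))
      where open ≡-Reasoning

weight-off-prefix : (m≤n : m ≤ n) (x : Config n) →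
                    (∀ t → x (inject≤ t m≤n) ≡ false) → m + weight x ≤ n
weight-off-prefix z≤n       x _         = weight-≤ x
weight-off-prefix (s≤s m≤n) x off-prefix rewrite off-prefix zero =
  s≤s (weight-off-prefix m≤n (tail x) (off-prefix ∘ suc))

modNetwork-independent : (d : ℕ) → 0 < d → k + d ≤ n → Independent k (modNetwork {n} d)
modNetwork-independent d 0<d k+d≤n I I-inj a
  with t , t≤d , ∣z+t ← ∃-multiple-within d (weight (assign I a))
  with x , x-on-I , weight-x ← raise-weight (image I) (assign I a) t (assign-outside I a)
                                  (≤-trans (+-mono-≤ (weight-image-≤ I) t≤d) k+d≤n)
  = x
  , modNetwork-fixed d 0<d x (subst (suc d ∣_) (sym weight-x) ∣z+t)
  , λ s → trans (x-on-I (I s) (image-∋ I s)) (assign-∘ I I-inj a s)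

modNetwork-not-independent : (d : ℕ) → 2 ≤ m → m ≤ n → n < m + d →
                             ¬ Independent m (modNetwork {n} d)
modNetwork-not-independent {suc (suc m)} {suc n} d (s≤s (s≤s z≤n)) m≤n n<m+d indep
  with x , x-fixed , x∘I≡pattern ← indep (λ t → inject≤ t m≤n)
                                         (λ {s} {t} → inject≤-injective m≤n m≤n s t)
                                         (true ∷ const false)
  = <⇒≱ (≤-trans (+-monoʳ-≤ (suc m) d≤weight) prefix) (s≤s⁻¹ (s≤s⁻¹ n<m+d))
  where
  weight-x : weight x ≡ suc (weight (tail x))
  weight-x = cong (λ b → addBit b (weight (tail x))) (x∘I≡pattern zero)

  d≤weight : d ≤ weight (tail x)
  d≤weight = s≤s⁻¹ (∣⇒≤ (subst (suc d ∣_) weight-x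
                                (modNetwork-fixed⇒∣ d x x-fixed (x∘I≡pattern (suc zero)))))

  prefix : suc m + weight (tail x) ≤ n
  prefix = weight-off-prefix (s≤s⁻¹ m≤n) (tail x) (x∘I≡pattern ∘ suc)

∃-interactionGraph-K-indepNumber : 0 < k → k < n →
  ∃ λ (f : BN n) → (G f ≐ K n) × IndepNumber f k
∃-interactionGraph-K-indepNumber {k} {n} 0<k k<n =
  modNetwork d , modNetwork-graph d 0<d
  , <⇒≤ k<n
  , modNetwork-independent d 0<d (≤-reflexive k+d≡n)
  , λ m k<m m≤n → modNetwork-not-independent d (≤-trans (s≤s 0<k) k<m) m≤n
                    (subst (_< m + d) k+d≡n (+-monoˡ-< d k<m))
  where
  d : ℕ
  d = n ∸ k
  0<d : 0 < d
  0<d = m<n⇒0<n∸m k<n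
  k+d≡n : k + d ≡ n
  k+d≡n = m+[n∸m]≡n (<⇒≤ k<n)

≐⇒≅ : {D E : Digraph n} → D ≐ E → D ≅ E
≐⇒≅ D≐E = ↔-id _ , D≐E

proposition2p2 : (n : ℕ) → 2 ≤ n →
    Admissible (n ∸ 1) (K n) ×
    ((k : ℕ) → 1 ≤ k → k ≤ n ∸ 1 →
      ∃ λ (f : BN n) → (G f ≐ K n) × IndepNumber f k)
proposition2p2 (suc n) (s≤s 1≤n) =
  admissible , λ k 1≤k k≤n → ∃-interactionGraph-K-indepNumber 1≤k (s≤s k≤n)
  where
  admissible : Admissible n (K (suc n))
  admissible
    with f , G≐K , _ , independent , _ ← ∃-interactionGraph-K-indepNumber 1≤n ≤-refl
    = f , independent , ≐⇒≅ G≐K
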